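{- Let $\Gamma$ be a strongly regular graph on $n$ vertices with valency $k_1$ and nontrivial eigenvalues $r,s$, where $r,s\in\mathbb{Z}$, $r\ge3$, $s\le-2$, and $r+s>0$. Let $h=\sqrt{4r(r+1)s(s+1)+1}$ and $\psi(x)=(s+1)(x+1)((2s+1)x-1)$. Assume that $h\in\mathbb{Z}$ and $k_1=-rs+\frac{h+\epsilon}{2}$ for some $\epsilon\in\{1,-1\}$. Then $$n\ge-(2s+1)r+2+\frac{2\psi(r)}{h+1}.$$
   Context: Equivalently, $\Gamma$ corresponds to a symmetric $2$-class association scheme with first eigenmatrix $\begin{pmatrix}1&k_1&k_2\\1&r&-(r+1)\\1&s&-(s+1)\end{pmatrix}$, where $k_2=n-1-k_1$ is the valency of the complement. -}

module Defs where

open import Data.Nat as ℕ using (ℕ; zero; suc)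
open import Data.Integer as ℤ using (ℤ; +_; -_; _+_; _*_; _-_)
open import Data.Fin using (Fin; zero; suc)
open import Data.Bool using (Bool; true; false; _∧_; if_then_else_)
open import Data.Product using (Σ; ∃; _×_)
open import Relation.Binary.PropositionalEquality using (_≡_; _≢_)

sumℤ : ∀ {n} → (Fin n → ℤ) → ℤ
sumℤ {zero}  f = + 0
sumℤ {suc n} f = f zero + sumℤ (λ i → f (suc i))

count : ∀ {n} → (Fin n → Bool) → ℕ
count {zero}  p = 0
count {suc n} p = (if p zero then 1 else 0) ℕ.+ count (λ i → p (suc i))

record Graph (n : ℕ) : Set where
  field
    adj    : Fin n → Fin n → Bool
    symm   : ∀ i j → adj i j ≡ adj j i
    irrefl : ∀ i → adj i i ≡ false

module _ {n : ℕ} (G : Graph n) where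
  open Graph G

  degree : Fin n → ℕ
  degree i = count (adj i)

  commonNbrs : Fin n → Fin n → ℕ
  commonNbrs i j = count (λ l → adj i l ∧ adj j l)

  A : Fin n → Fin n → ℤ
  A i j = if adj i j then + 1 else + 0

  IsSRG : ℕ → ℕ → ℕ → Set
  IsSRG k λ′ μ =
      (∀ i → degree i ≡ k)
    × (∀ i j → i ≢ j → adj i j ≡ true  → commonNbrs i j ≡ λ′)
    × (∀ i j → i ≢ j → adj i j ≡ false → commonNbrs i j ≡ μ)

  -- θ ∈ ℤ is an eigenvalue of the adjacency matrix: A v = θ v for some
  -- nonzero (integer, equivalently rational/real since θ ∈ ℤ) vector v.
  IsEigenvalue : ℤ → Set
  IsEigenvalue θ = Σ (Fin n → ℤ) λ v →
    (∃ λ i → v i ≢ + 0) × (∀ i → sumℤ (λ j → A i j * v j) ≡ θ * v i)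

  NontrivialEigenvalues : ℕ → ℤ → ℤ → Set
  NontrivialEigenvalues k r s =
    IsEigenvalue r × IsEigenvalue s × r ≢ + k × s ≢ + k × r ≢ s

ψ : ℤ → ℤ → ℤ
ψ s x = (s + + 1) * (x + + 1) * ((+ 2 * s + + 1) * x - + 1)

module Submission where

-- The adjacency matrix of a strongly regular graph satisfies A² = (k − μ)I + (λ − μ)A + μJ.
-- Applied to an eigenvector for r or s (whose entries sum to zero, since every column of A sums
-- to k ≠ r, s) this makes r and s the roots of x² − (λ − μ)x − (k − μ), so λ − μ = r + s and
-- μ = k + rs; applied to the all-ones vector it gives k(k − λ − 1) = μ(n − 1 − k), that is
-- (k + rs)(n − 1 − k) = −k(r + 1)(s + 1). Since 2(k + rs) = h + ε and
-- (h + ε)(h − ε) = h² − 1 = 4r(r + 1)s(s + 1), the nonzero factor h + ε cancels and leaves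
-- n = h − 2rs − r − s exactly. The claimed bound then differs from n by
-- −(s + 1)(2r² − 1 + h)/(h + 1) ≥ 0.

open import Defs
open import Data.Nat as ℕ using (ℕ; zero; suc; z≤n; s≤s)
import Data.Nat.Properties as ℕ
open import Data.Integer using (ℤ; +_; -_; _+_; _*_; _-_; _≤_; _<_; 0ℤ; -[1+_]; +≤+; -≤-; ≢-nonZero)
import Data.Integer.Properties as ℤ
open import Data.Integer.Tactic.RingSolver using (solve; solve-∀)
open import Data.Rational.Unnormalised using (_/_; _≃_; *≡*; *≤*) renaming (_≤_ to _≤ᵤ_; _+_ to _+ᵤ_)
open import Data.Fin using (Fin; zero; suc)
open import Data.Fin.Properties using (_≟_)
open import Data.Bool using (Bool; true; false; _∧_; if_then_else_)
open import Data.Bool.Properties using (∧-idem)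
open import Data.List using ([]; _∷_)
open import Data.Product using (_×_; _,_; proj₁; proj₂)
open import Data.Sum using (_⊎_; inj₁; inj₂)
open import Relation.Nullary using (yes; no; contradiction)
open import Function using (_∘_)
open import Relation.Binary.PropositionalEquality
  using (_≡_; _≢_; refl; sym; trans; cong; cong₂; subst; subst₂; module ≡-Reasoning)
open import Algebra.Properties.CommutativeSemigroup ℤ.*-commutativeSemigroup using (x∙yz≈y∙xz)
open import Algebra.Properties.Semiring.Sum ℤ.+-*-semiring
  using (sum; sum-syntax; sum-cong-≗; ∑-distrib-+; ∑-comm; *-distribˡ-sum; *-distribʳ-sum)

open ≡-Reasoning

sumℤ≡sum : ∀ {n} (f : Fin n → ℤ) → sumℤ f ≡ sum f
sumℤ≡sum {zero}  f = refl
sumℤ≡sum {suc n} f = cong (_+_ (f zero)) (sumℤ≡sum (λ i → f (suc i)))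

∑-const : ∀ n (c : ℤ) → ∑[ i < n ] c ≡ + n * c
∑-const zero    c = sym (ℤ.*-zeroˡ c)
∑-const (suc n) c = begin
  c + ∑[ i < n ] c ≡⟨ cong (_+_ c) (∑-const n c) ⟩
  c + + n * c       ≡⟨ cong (_+ + n * c) (sym (ℤ.*-identityˡ c)) ⟩
  + 1 * c + + n * c ≡⟨ sym (ℤ.*-distribʳ-+ c (+ 1) (+ n)) ⟩
  + suc n * c       ∎

indicator : Bool → ℤ
indicator b = if b then + 1 else + 0

indicator-∧ : ∀ b c → indicator b * indicator c ≡ indicator (b ∧ c)
indicator-∧ true  true  = refl
indicator-∧ true  false = refl
indicator-∧ false c     = refl

∑-indicator : ∀ {n} (p : Fin n → Bool) → ∑[ i < n ] indicator (p i) ≡ + count p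
∑-indicator {zero}  p = refl
∑-indicator {suc n} p with p zero
... | true  = trans (cong (_+_ (+ 1)) (∑-indicator (λ i → p (suc i)))) (sym (ℤ.pos-+ 1 _))
... | false = trans (ℤ.+-identityˡ _) (∑-indicator (λ i → p (suc i)))

count-cong : ∀ {n} {p q : Fin n → Bool} → (∀ i → p i ≡ q i) → count p ≡ count q
count-cong {zero}  p≗q = refl
count-cong {suc n} p≗q =
  cong₂ ℕ._+_ (cong (λ b → if b then 1 else 0) (p≗q zero)) (count-cong (λ i → p≗q (suc i)))

δ : ∀ {n} → Fin n → Fin n → ℤ
δ zero    zero    = + 1
δ zero    (suc _) = + 0
δ (suc _) zero    = + 0
δ (suc i) (suc j) = δ i j

δ-refl : ∀ {n} (i : Fin n) → δ i i ≡ + 1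
δ-refl zero    = refl
δ-refl (suc i) = δ-refl i

δ-≢ : ∀ {n} {i j : Fin n} → i ≢ j → δ i j ≡ + 0
δ-≢ {i = zero}  {zero}  i≢j = contradiction refl i≢j
δ-≢ {i = zero}  {suc j} i≢j = refl
δ-≢ {i = suc i} {zero}  i≢j = refl
δ-≢ {i = suc i} {suc j} i≢j = δ-≢ (λ i≡j → i≢j (cong suc i≡j))

∑-δ : ∀ {n} (i : Fin n) (v : Fin n → ℤ) → ∑[ j < n ] (δ i j * v j) ≡ v i
∑-δ {suc n} zero v = begin
  + 1 * v zero + ∑[ j < n ] (+ 0 * v (suc j)) ≡⟨ cong (_+_ (+ 1 * v zero)) (∑-const n 0ℤ) ⟩
  + 1 * v zero + + n * + 0                    ≡⟨ cong₂ _+_ (ℤ.*-identityˡ (v zero)) (ℤ.*-zeroʳ (+ n)) ⟩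
  v zero + + 0                                ≡⟨ ℤ.+-identityʳ (v zero) ⟩
  v zero                                      ∎
∑-δ {suc n} (suc i) v = trans (ℤ.+-identityˡ _) (∑-δ i (λ j → v (suc j)))

module _ {n : ℕ} (Γ : Graph n) where
  open Graph Γ

  A·_ : (Fin n → ℤ) → Fin n → ℤ
  (A· v) i = ∑[ j < n ] (A Γ i j * v j)

  A-symmetric : ∀ i j → A Γ i j ≡ A Γ j i
  A-symmetric i j = cong indicator (symm i j)

  row-sum≡degree : ∀ i → ∑[ j < n ] A Γ i j ≡ + degree Γ i
  row-sum≡degree i = ∑-indicator (adj i)

  A²≡commonNbrs : ∀ i l → ∑[ j < n ] (A Γ i j * A Γ j l) ≡ + commonNbrs Γ i l
  A²≡commonNbrs i l = begin
    ∑[ j < n ] (A Γ i j * A Γ j l)            ≡⟨ sum-cong-≗ (λ j → cong (A Γ i j *_) (A-symmetric j l)) ⟩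
    ∑[ j < n ] (A Γ i j * A Γ l j)            ≡⟨ sum-cong-≗ (λ j → indicator-∧ (adj i j) (adj l j)) ⟩
    ∑[ j < n ] indicator (adj i j ∧ adj l j)  ≡⟨ ∑-indicator (λ j → adj i j ∧ adj l j) ⟩
    + commonNbrs Γ i l                        ∎

  A·A·-commonNbrs : ∀ v i → (A· (A· v)) i ≡ ∑[ l < n ] (+ commonNbrs Γ i l * v l)
  A·A·-commonNbrs v i = begin
    ∑[ j < n ] (A Γ i j * ∑[ l < n ] (A Γ j l * v l))
      ≡⟨ sum-cong-≗ (λ j → *-distribˡ-sum (A Γ i j) (λ l → A Γ j l * v l)) ⟩
    ∑[ j < n ] ∑[ l < n ] (A Γ i j * (A Γ j l * v l))
      ≡⟨ ∑-comm {n} {n} _ ⟩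
    ∑[ l < n ] ∑[ j < n ] (A Γ i j * (A Γ j l * v l))
      ≡⟨ sum-cong-≗ (λ l → sum-cong-≗ (λ j → sym (ℤ.*-assoc (A Γ i j) (A Γ j l) (v l)))) ⟩
    ∑[ l < n ] ∑[ j < n ] (A Γ i j * A Γ j l * v l)
      ≡⟨ sum-cong-≗ (λ l → sym (*-distribʳ-sum (v l) (λ j → A Γ i j * A Γ j l))) ⟩
    ∑[ l < n ] (∑[ j < n ] (A Γ i j * A Γ j l) * v l)
      ≡⟨ sum-cong-≗ (λ l → cong (_* v l) (A²≡commonNbrs i l)) ⟩
    ∑[ l < n ] (+ commonNbrs Γ i l * v l)
      ∎

  module _ {k λ′ μ : ℕ} (srg : IsSRG Γ k λ′ μ) where
    private
      K L M : ℤ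
      K = + k
      L = + λ′
      M = + μ

    row-sum : ∀ i → ∑[ j < n ] A Γ i j ≡ K
    row-sum i = trans (row-sum≡degree i) (cong +_ (proj₁ srg i))

    column-sum : ∀ j → ∑[ i < n ] A Γ i j ≡ K
    column-sum j = trans (sum-cong-≗ (λ i → A-symmetric i j)) (row-sum j)

    commonNbrs-srg : ∀ i l → + commonNbrs Γ i l ≡ (K - M) * δ i l + (L - M) * A Γ i l + M
    commonNbrs-srg i l with i ≟ l
    ... | yes refl rewrite δ-refl i | irrefl i = begin
      + count (λ j → adj i j ∧ adj i j)  ≡⟨ cong +_ (count-cong (λ j → ∧-idem (adj i j))) ⟩
      + degree Γ i                       ≡⟨ cong +_ (proj₁ srg i) ⟩
      K                                  ≡⟨ diagonal K L M ⟩
      (K - M) * + 1 + (L - M) * + 0 + M  ∎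
      where
      diagonal : ∀ x y z → x ≡ (x - z) * + 1 + (y - z) * + 0 + z
      diagonal = solve-∀
    ... | no i≢l rewrite δ-≢ i≢l with adj i l in adj-il
    ...   | true  = trans (cong +_ (proj₁ (proj₂ srg) i l i≢l adj-il)) (adjacent K L M)
      where
      adjacent : ∀ x y z → y ≡ (x - z) * + 0 + (y - z) * + 1 + z
      adjacent = solve-∀
    ...   | false = trans (cong +_ (proj₂ (proj₂ srg) i l i≢l adj-il)) (nonadjacent K L M)
      where
      nonadjacent : ∀ x y z → z ≡ (x - z) * + 0 + (y - z) * + 0 + z
      nonadjacent = solve-∀

    A·A·-srg : ∀ v i → (A· (A· v)) i ≡ (K - M) * v i + (L - M) * (A· v) i + M * ∑[ l < n ] v l
    A·A·-srg v i = begin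
      (A· (A· v)) i
        ≡⟨ A·A·-commonNbrs v i ⟩
      ∑[ l < n ] (+ commonNbrs Γ i l * v l)
        ≡⟨ sum-cong-≗ (λ l → cong (_* v l) (commonNbrs-srg i l)) ⟩
      ∑[ l < n ] (((K - M) * δ i l + (L - M) * A Γ i l + M) * v l)
        ≡⟨ sum-cong-≗ (λ l → expand (K - M) (L - M) M (δ i l) (A Γ i l) (v l)) ⟩
      ∑[ l < n ] ((K - M) * (δ i l * v l) + (L - M) * (A Γ i l * v l) + M * v l)
        ≡⟨ ∑-distrib-+ {n} _ _ ⟩
      ∑[ l < n ] ((K - M) * (δ i l * v l) + (L - M) * (A Γ i l * v l)) + ∑[ l < n ] (M * v l)
        ≡⟨ cong (_+ ∑[ l < n ] (M * v l)) (∑-distrib-+ {n} _ _) ⟩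
      ∑[ l < n ] ((K - M) * (δ i l * v l)) + ∑[ l < n ] ((L - M) * (A Γ i l * v l)) + ∑[ l < n ] (M * v l)
        ≡⟨ sym (cong₂ _+_ (cong₂ _+_ (*-distribˡ-sum (K - M) (λ l → δ i l * v l))
                                     (*-distribˡ-sum (L - M) (λ l → A Γ i l * v l)))
                          (*-distribˡ-sum M v)) ⟩
      (K - M) * ∑[ l < n ] (δ i l * v l) + (L - M) * (A· v) i + M * ∑[ l < n ] v l
        ≡⟨ cong (λ x → (K - M) * x + (L - M) * (A· v) i + M * ∑[ l < n ] v l) (∑-δ i v) ⟩
      (K - M) * v i + (L - M) * (A· v) i + M * ∑[ l < n ] v l
        ∎
      where
      expand : ∀ p q m d a x → (p * d + q * a + m) * x ≡ p * (d * x) + q * (a * x) + m * x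
      expand = solve-∀

    ∑-A· : ∀ v → ∑[ i < n ] (A· v) i ≡ K * ∑[ j < n ] v j
    ∑-A· v = begin
      ∑[ i < n ] ∑[ j < n ] (A Γ i j * v j)
        ≡⟨ ∑-comm {n} {n} _ ⟩
      ∑[ j < n ] ∑[ i < n ] (A Γ i j * v j)
        ≡⟨ sum-cong-≗ (λ j → sym (*-distribʳ-sum (v j) (λ i → A Γ i j))) ⟩
      ∑[ j < n ] (∑[ i < n ] A Γ i j * v j)
        ≡⟨ sum-cong-≗ (λ j → cong (_* v j) (column-sum j)) ⟩
      ∑[ j < n ] (K * v j)
        ≡⟨ sym (*-distribˡ-sum K v) ⟩
      K * ∑[ j < n ] v j
        ∎

    module _ {θ : ℤ} {v : Fin n → ℤ} (eigenvector : ∀ i → (A· v) i ≡ θ * v i) where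

      ∑-eigenvector≡0 : θ ≢ K → ∑[ j < n ] v j ≡ 0ℤ
      ∑-eigenvector≡0 θ≢K with ∑[ j < n ] v j ℤ.≟ 0ℤ
      ... | yes ∑v≡0 = ∑v≡0
      ... | no  ∑v≢0 = contradiction (ℤ.*-cancelʳ-≡ θ K _ {{≢-nonZero ∑v≢0}} θ∑v≡K∑v) θ≢K
        where
        θ∑v≡K∑v : θ * ∑[ j < n ] v j ≡ K * ∑[ j < n ] v j
        θ∑v≡K∑v = begin
          θ * ∑[ j < n ] v j         ≡⟨ *-distribˡ-sum θ v ⟩
          ∑[ j < n ] (θ * v j)       ≡⟨ sum-cong-≗ (λ j → sym (eigenvector j)) ⟩
          ∑[ j < n ] (A· v) j        ≡⟨ ∑-A· v ⟩
          K * ∑[ j < n ] v j         ∎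

      A·A·-eigenvector : ∀ i → (A· (A· v)) i ≡ θ * (θ * v i)
      A·A·-eigenvector i = begin
        ∑[ j < n ] (A Γ i j * (A· v) j)  ≡⟨ sum-cong-≗ (λ j → cong (A Γ i j *_) (eigenvector j)) ⟩
        ∑[ j < n ] (A Γ i j * (θ * v j)) ≡⟨ sum-cong-≗ (λ j → x∙yz≈y∙xz (A Γ i j) θ (v j)) ⟩
        ∑[ j < n ] (θ * (A Γ i j * v j)) ≡⟨ sym (*-distribˡ-sum θ (λ j → A Γ i j * v j)) ⟩
        θ * (A· v) i                      ≡⟨ cong (θ *_) (eigenvector i) ⟩
        θ * (θ * v i)                     ∎

    eigenvalue-equation : ∀ {θ} → IsEigenvalue Γ θ → θ ≢ K → θ * θ ≡ (K - M) + (L - M) * θ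
    eigenvalue-equation {θ} (v , (i , vᵢ≢0) , Av≡θv) θ≢K =
      ℤ.*-cancelʳ-≡ _ _ (v i) {{≢-nonZero vᵢ≢0}} (begin
        θ * θ * v i                                    ≡⟨ ℤ.*-assoc θ θ (v i) ⟩
        θ * (θ * v i)                                  ≡⟨ sym (A·A·-eigenvector {θ} eigenvector i) ⟩
        (A· (A· v)) i                                  ≡⟨ A·A·-srg v i ⟩
        (K - M) * v i + (L - M) * (A· v) i + M * ∑[ j < n ] v j
          ≡⟨ cong₂ (λ x y → (K - M) * v i + (L - M) * x + M * y)
                   (eigenvector i) (∑-eigenvector≡0 {θ} eigenvector θ≢K) ⟩
        (K - M) * v i + (L - M) * (θ * v i) + M * 0ℤ   ≡⟨ collect (K - M) (L - M) M θ (v i) ⟩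
        ((K - M) + (L - M) * θ) * v i                  ∎)
      where
      eigenvector : ∀ j → (A· v) j ≡ θ * v j
      eigenvector j = trans (sym (sumℤ≡sum {n} _)) (Av≡θv j)
      collect : ∀ p q m t x → p * x + q * (t * x) + m * 0ℤ ≡ (p + q * t) * x
      collect = solve-∀

    valency-equation : Fin n → K * K ≡ (K - M) + (L - M) * K + M * + n
    valency-equation i = begin
      K * K                                          ≡⟨ cong (_* K) (sym (row-sum i)) ⟩
      (∑[ j < n ] A Γ i j) * K                       ≡⟨ *-distribʳ-sum K (A Γ i) ⟩
      ∑[ j < n ] (A Γ i j * K)                       ≡⟨ sum-cong-≗ (λ j → cong (A Γ i j *_) (sym (A·𝟙 j))) ⟩
      (A· (A· 𝟙)) i                                  ≡⟨ A·A·-srg 𝟙 i ⟩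
      (K - M) * + 1 + (L - M) * (A· 𝟙) i + M * ∑[ j < n ] (+ 1)
        ≡⟨ cong₂ (λ x y → (K - M) * + 1 + (L - M) * x + M * y) (A·𝟙 i) (∑-const n (+ 1)) ⟩
      (K - M) * + 1 + (L - M) * K + M * (+ n * + 1)  ≡⟨ tidy (K - M) (L - M) M K (+ n) ⟩
      (K - M) + (L - M) * K + M * + n                ∎
      where
      𝟙 : Fin n → ℤ
      𝟙 _ = + 1
      A·𝟙 : ∀ j → (A· 𝟙) j ≡ K
      A·𝟙 j = trans (sum-cong-≗ (λ l → ℤ.*-identityʳ (A Γ j l))) (row-sum j)
      tidy : ∀ p q m k x → p * + 1 + q * k + m * (x * + 1) ≡ p + q * k + m * x
      tidy = solve-∀

factor≡0 : ∀ {a b : ℤ} → a ≢ 0ℤ → a * b ≡ 0ℤ → b ≡ 0ℤ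
factor≡0 {a} a≢0 ab≡0 with ℤ.i*j≡0⇒i≡0∨j≡0 a ab≡0
... | inj₁ a≡0 = contradiction a≡0 a≢0
... | inj₂ b≡0 = b≡0

distinct-roots⇒vieta : ∀ {a b r s : ℤ} → r ≢ s → r * r ≡ a + b * r → s * s ≡ a + b * s →
                       b ≡ r + s × a ≡ - (r * s)
distinct-roots⇒vieta {a} {b} {r} {s} r≢s r-root s-root = b≡r+s , a≡-rs
  where
  [r-s][b-r-s]≡0 : (r - s) * (b - (r + s)) ≡ 0ℤ
  [r-s][b-r-s]≡0 = begin
    (r - s) * (b - (r + s))
      ≡⟨ solve (a ∷ b ∷ r ∷ s ∷ []) ⟩
    (a + b * r - r * r) - (a + b * s - s * s)
      ≡⟨ cong₂ (λ x y → (a + b * r - x) - (a + b * s - y)) r-root s-root ⟩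
    (a + b * r - (a + b * r)) - (a + b * s - (a + b * s))
      ≡⟨ solve (a ∷ b ∷ r ∷ s ∷ []) ⟩
    0ℤ
      ∎

  b≡r+s : b ≡ r + s
  b≡r+s = ℤ.i-j≡0⇒i≡j b (r + s) (factor≡0 (r≢s ∘ ℤ.i-j≡0⇒i≡j r s) [r-s][b-r-s]≡0)

  a≡-rs : a ≡ - (r * s)
  a≡-rs = begin
    a                    ≡⟨ solve (a ∷ b ∷ r ∷ []) ⟩
    a + b * r - b * r    ≡⟨ cong (_- b * r) (sym r-root) ⟩
    r * r - b * r        ≡⟨ cong (λ x → r * r - x * r) b≡r+s ⟩
    r * r - (r + s) * r  ≡⟨ solve (r ∷ s ∷ []) ⟩
    - (r * s)            ∎

-- k(k − λ − 1) = μ(n − 1 − k), with λ − μ = r + s and μ = k + rs substituted.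
feasibility : ∀ {r s K L M N : ℤ} → L - M ≡ r + s → K - M ≡ - (r * s) →
              K * K ≡ (K - M) + (L - M) * K + M * N →
              (K + r * s) * (N - + 1 - K) + K * ((r + + 1) * (s + + 1)) ≡ 0ℤ
feasibility {r} {s} {K} {L} {M} {N} λ-μ≡r+s k-μ≡-rs valency = begin
  (K + r * s) * (N - + 1 - K) + K * ((r + + 1) * (s + + 1))
    ≡⟨ solve (r ∷ s ∷ K ∷ N ∷ []) ⟩
  (K - - (r * s)) * N + (r + s) * K + - (r * s) - K * K
    ≡⟨ cong₂ (λ a b → (K - a) * N + b * K + a - K * K) (sym k-μ≡-rs) (sym λ-μ≡r+s) ⟩
  (K - (K - M)) * N + (L - M) * K + (K - M) - K * K
    ≡⟨ cong (_-_ ((K - (K - M)) * N + (L - M) * K + (K - M))) valency ⟩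
  (K - (K - M)) * N + (L - M) * K + (K - M) - ((K - M) + (L - M) * K + M * N)
    ≡⟨ solve (K ∷ L ∷ M ∷ N ∷ []) ⟩
  0ℤ
    ∎

vertex-count : ∀ {r s K N h ε : ℤ} → + 4 * r * (r + + 1) * s * (s + + 1) ≢ 0ℤ →
               h * h ≡ + 4 * r * (r + + 1) * s * (s + + 1) + + 1 → ε * ε ≡ + 1 →
               + 2 * K ≡ + 2 * - (r * s) + (h + ε) →
               (K + r * s) * (N - + 1 - K) + K * ((r + + 1) * (s + + 1)) ≡ 0ℤ →
               N ≡ h - + 2 * r * s - r - s
vertex-count {r} {s} {K} {N} {h} {ε} P≢0 h² ε² 2k≡-2rs+h+ε feasible =
  ℤ.i-j≡0⇒i≡j N _ (factor≡0 {+ 2} (λ ()) (factor≡0 h+ε≢0 [h+ε]2[N-n]≡0))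
  where
  P : ℤ
  P = + 4 * r * (r + + 1) * s * (s + + 1)

  h²-ε² : h * h - ε * ε ≡ P
  h²-ε² = begin
    h * h - ε * ε      ≡⟨ cong₂ _-_ h² ε² ⟩
    P + + 1 - + 1      ≡⟨ ℤ.+-assoc P (+ 1) (- + 1) ⟩
    P + 0ℤ             ≡⟨ ℤ.+-identityʳ P ⟩
    P                  ∎

  2[k+rs]≡h+ε : + 2 * (K + r * s) ≡ h + ε
  2[k+rs]≡h+ε = begin
    + 2 * (K + r * s)                          ≡⟨ solve (r ∷ s ∷ K ∷ []) ⟩
    + 2 * K + + 2 * (r * s)                    ≡⟨ cong (_+ + 2 * (r * s)) 2k≡-2rs+h+ε ⟩
    + 2 * - (r * s) + (h + ε) + + 2 * (r * s)  ≡⟨ solve (r ∷ s ∷ h ∷ ε ∷ []) ⟩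
    h + ε                                      ∎

  h+ε≢0 : h + ε ≢ 0ℤ
  h+ε≢0 h+ε≡0 = P≢0 (begin
    P                  ≡⟨ sym h²-ε² ⟩
    h * h - ε * ε      ≡⟨ solve (h ∷ ε ∷ []) ⟩
    (h + ε) * (h - ε)  ≡⟨ cong (_* (h - ε)) h+ε≡0 ⟩
    0ℤ * (h - ε)       ≡⟨ ℤ.*-zeroˡ (h - ε) ⟩
    0ℤ                 ∎)

  [h+ε]2[N-n]≡0 : (h + ε) * (+ 2 * (N - (h - + 2 * r * s - r - s))) ≡ 0ℤ
  [h+ε]2[N-n]≡0 = begin
    (h + ε) * (+ 2 * (N - (h - + 2 * r * s - r - s)))
      ≡⟨ solve (r ∷ s ∷ N ∷ h ∷ ε ∷ []) ⟩
    (h + ε) * (+ 2 * (N - + 1) - (h + ε) + + 2 * (r * s) + + 2 * ((r + + 1) * (s + + 1))) - (h * h - ε * ε)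
      ≡⟨ cong₂ (λ x y → x * (+ 2 * (N - + 1) - x + + 2 * (r * s) + + 2 * ((r + + 1) * (s + + 1))) - y)
               (sym 2[k+rs]≡h+ε) h²-ε² ⟩
    + 2 * (K + r * s) * (+ 2 * (N - + 1) - + 2 * (K + r * s) + + 2 * (r * s) + + 2 * ((r + + 1) * (s + + 1)))
      - + 4 * r * (r + + 1) * s * (s + + 1)
      ≡⟨ solve (r ∷ s ∷ K ∷ N ∷ []) ⟩
    + 4 * ((K + r * s) * (N - + 1 - K) + K * ((r + + 1) * (s + + 1)))
      ≡⟨ cong (+ 4 *_) feasible ⟩
    0ℤ
      ∎

-- With r and s in constructor form both factors normalise to casts of natural numbers.
0≤-[1+s]*[r²+r²-1+h] : ∀ {r s h : ℤ} → + 1 ≤ r → s ≤ - + 1 → 0ℤ ≤ h →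
                       0ℤ ≤ - (s + + 1) * (r * r + (r * r - + 1) + h)
0≤-[1+s]*[r²+r²-1+h] {+ suc _} { -[1+ zero ]  } {+ _} (+≤+ (s≤s z≤n)) _ (+≤+ z≤n) = +≤+ z≤n
0≤-[1+s]*[r²+r²-1+h] {+ suc _} { -[1+ suc _ ] } {+ _} (+≤+ (s≤s z≤n)) _ (+≤+ z≤n) = +≤+ z≤n

lower-bound : ∀ {r s N h : ℤ} → + 1 ≤ r → s ≤ - + 1 → 0ℤ ≤ h →
              h * h ≡ + 4 * r * (r + + 1) * s * (s + + 1) + + 1 →
              N ≡ h - + 2 * r * s - r - s →
              (- ((+ 2 * s + + 1) * r) + + 2) * (+ 1 + h) + + 2 * ψ s r ≤ N * (+ 1 + h)
lower-bound {r} {s} {N} {h} 1≤r s≤-1 0≤h h² N≡ =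
  ℤ.0≤i-j⇒j≤i (subst (0ℤ ≤_) (sym gap) (0≤-[1+s]*[r²+r²-1+h] 1≤r s≤-1 0≤h))
  where
  gap : N * (+ 1 + h) - ((- ((+ 2 * s + + 1) * r) + + 2) * (+ 1 + h) + + 2 * ψ s r)
        ≡ - (s + + 1) * (r * r + (r * r - + 1) + h)
  gap = begin
    N * (+ 1 + h) - ((- ((+ 2 * s + + 1) * r) + + 2) * (+ 1 + h) + + 2 * ψ s r)
      ≡⟨ cong (λ x → x * (+ 1 + h) - ((- ((+ 2 * s + + 1) * r) + + 2) * (+ 1 + h) + + 2 * ψ s r))
              N≡ ⟩
    (h - + 2 * r * s - r - s) * (+ 1 + h)
      - ((- ((+ 2 * s + + 1) * r) + + 2) * (+ 1 + h) + + 2 * ((s + + 1) * (r + + 1) * ((+ 2 * s + + 1) * r - + 1)))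
      ≡⟨ solve (r ∷ s ∷ h ∷ []) ⟩
    h * h - (s + + 1) * h - (s + + 2) - + 2 * ((s + + 1) * (r + + 1) * ((+ 2 * s + + 1) * r - + 1))
      ≡⟨ cong (λ x → x - (s + + 1) * h - (s + + 2) - + 2 * ((s + + 1) * (r + + 1) * ((+ 2 * s + + 1) * r - + 1)))
              h² ⟩
    + 4 * r * (r + + 1) * s * (s + + 1) + + 1 - (s + + 1) * h - (s + + 2)
      - + 2 * ((s + + 1) * (r + + 1) * ((+ 2 * s + + 1) * r - + 1))
      ≡⟨ solve (r ∷ s ∷ h ∷ []) ⟩
    - (s + + 1) * (r * r + (r * r - + 1) + h)
      ∎

r[r+1]s[s+1]≢0 : ∀ {r s : ℤ} → + 1 ≤ r → s ≤ - + 2 → + 4 * r * (r + + 1) * s * (s + + 1) ≢ 0ℤ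
r[r+1]s[s+1]≢0 {+ suc _} { -[1+ suc _ ] } (+≤+ (s≤s z≤n)) (-≤- (s≤s z≤n)) ()

±1²≡1 : ∀ {ε : ℤ} → ε ≡ + 1 ⊎ ε ≡ - + 1 → ε * ε ≡ + 1
±1²≡1 (inj₁ refl) = refl
±1²≡1 (inj₂ refl) = refl

k≃a+b/2⇒2k≡2a+b : ∀ {k a b : ℤ} → k / 1 ≃ a / 1 +ᵤ b / 2 → + 2 * k ≡ + 2 * a + b
k≃a+b/2⇒2k≡2a+b {k} {a} {b} (*≡* k*2≡[a*2+b*1]*1) = begin
  + 2 * k                    ≡⟨ ℤ.*-comm (+ 2) k ⟩
  k * + 2                    ≡⟨ k*2≡[a*2+b*1]*1 ⟩
  (a * + 2 + b * + 1) * + 1  ≡⟨ solve (a ∷ b ∷ []) ⟩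
  + 2 * a + b                ∎

a+b/[1+h]≤ᵤN : ∀ {a b N : ℤ} {h : ℕ} → a * (+ 1 + + h) + b ≤ N * (+ 1 + + h) →
               a / 1 +ᵤ b / suc h ≤ᵤ N / 1
a+b/[1+h]≤ᵤN {a} {b} {N} {h} cross = *≤* (subst₂ _≤_
  (sym (trans (ℤ.*-identityʳ _) (cong (_+_ (a * + suc h)) (ℤ.*-identityʳ b))))
  (cong (λ d → N * + suc d) (sym (ℕ.+-identityʳ h)))
  cross)

lemma6p6 : (n : ℕ) (Γ : Graph n) (k₁ λ′ μ : ℕ) (r s : ℤ) →
    IsSRG Γ k₁ λ′ μ →
    NontrivialEigenvalues Γ k₁ r s →
    + 3 ≤ r → s ≤ - (+ 2) → + 0 < r + s →
    (h : ℕ) → (+ h) * (+ h) ≡ + 4 * r * (r + + 1) * s * (s + + 1) + + 1 →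
    (ε : ℤ) → (ε ≡ + 1 ⊎ ε ≡ - (+ 1)) →
    ((+ k₁) / 1) ≃ ((- (r * s)) / 1 +ᵤ (+ h + ε) / 2) →
    ((- ((+ 2 * s + + 1) * r) + + 2) / 1 +ᵤ (+ 2 * ψ s r) / suc h) ≤ᵤ ((+ n) / 1)
lemma6p6 n Γ k λ′ μ r s srg (r-eigen@(_ , (i , _) , _) , s-eigen , r≢k , s≢k , r≢s) 3≤r s≤-2 _
         h h² ε ε≡±1 k≃-rs+[h+ε]/2 =
  a+b/[1+h]≤ᵤN {a = - ((+ 2 * s + + 1) * r) + + 2} {b = + 2 * ψ s r}
    (lower-bound 1≤r s≤-1 (+≤+ z≤n) h² n≡h-2rs-r-s)
  where
  1≤r : + 1 ≤ r
  1≤r = ℤ.≤-trans (+≤+ (s≤s z≤n)) 3≤r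

  s≤-1 : s ≤ - + 1
  s≤-1 = ℤ.≤-trans s≤-2 (-≤- z≤n)

  vieta : + λ′ - + μ ≡ r + s × + k - + μ ≡ - (r * s)
  vieta = distinct-roots⇒vieta r≢s (eigenvalue-equation Γ srg r-eigen r≢k)
                                   (eigenvalue-equation Γ srg s-eigen s≢k)

  n≡h-2rs-r-s : + n ≡ + h - + 2 * r * s - r - s
  n≡h-2rs-r-s = vertex-count {r} {s} {+ k} {+ n} {+ h} {ε}
    (r[r+1]s[s+1]≢0 1≤r s≤-2) h² (±1²≡1 ε≡±1)
    (k≃a+b/2⇒2k≡2a+b {a = - (r * s)} {b = + h + ε} k≃-rs+[h+ε]/2)
    (feasibility {r} {s} {+ k} {+ λ′} {+ μ} {+ n} (proj₁ vieta) (proj₂ vieta) (valency-equation Γ srg i))
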